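{- Let $\mathbf{A}$ be a Heyting algebra, $\nabla$ a filter of $\mathbf{A}$ containing all dense elements, and $\Delta_1,\Delta_2$ ideals of $\mathbf{A}$. Let $\varphi$ be a formula of the form $\varphi=\psi(p_1,\dots,p_n,\ q_1\vee\sim q_1,\dots,q_m\vee\sim q_m)$, where $\psi(p_1,\dots,p_n,q_1,\dots,q_m)$ is a formula in the language $\{\wedge,\vee,\to,\bot\}$ (without $\sim$) and $\{p_1,\dots,p_n\}\cap\{q_1,\dots,q_m\}=\varnothing$ ($m=0$ allowed). Then $Tw(\mathbf{A},\nabla,\Delta_1)\models\varphi$ if and only if $Tw(\mathbf{A},\nabla,\Delta_2)\models\varphi$.
   Context: In a Heyting algebra $\mathbf{A}$, $\neg a:=a\to\bot$; $a$ is dense if $\neg a=\bot$. For a filter $\nabla$ containing all dense elements and an ideal $\Delta$, $Tw(\mathbf{A},\nabla,\Delta)$ is the algebra with universe $\{(a,b)\in A\times A:a\vee b\in\nabla,\ a\wedge b\in\Delta\}$ and operations $(a,b)\vee(c,d)=(a\vee c,b\wedge d)$, $(a,b)\wedge(c,d)=(a\wedge c,b\vee d)$, $(a,b)\to(c,d)=(a\to c,a\wedge d)$, $\bot=(\bot,1)$, $\sim(a,b)=(b,a)$; it is a twist-structure over $\mathbf{A}$ (its first projection is all of $A$). Formulas are in the language $\{\wedge,\vee,\to,\bot,\sim\}$ over propositional variables; $\mathcal{A}\models\varphi$ iff $\pi_1(v(\varphi))=1$ for every homomorphism $v$ from the formula algebra into $\mathcal{A}$, $\pi_1$ being the first projection.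 -}

module Defs where

open import Level using (Level; _⊔_; suc)
open import Data.Nat using (ℕ)
open import Data.Fin using (Fin)
open import Data.Sum using (_⊎_; inj₁; inj₂)
open import Data.Product using (_×_; _,_; proj₁; proj₂)
open import Relation.Unary using (Pred; _∈_)
open import Relation.Binary.Lattice.Bundles using (HeytingAlgebra)

data Fm (V : Set) : Set where
  var  : V → Fm V
  ⊥f   : Fm V
  _∧f_ : Fm V → Fm V → Fm V
  _∨f_ : Fm V → Fm V → Fm V
  _⇒f_ : Fm V → Fm V → Fm V
  ∼f_  : Fm V → Fm V

data PFm (V : Set) : Set where
  pvar  : V → PFm V
  p⊥    : PFm V
  _p∧_  : PFm V → PFm V → PFm V
  _p∨_  : PFm V → PFm V → PFm V
  _p⇒_  : PFm V → PFm V → PFm V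

psubst : {V W : Set} → (V → Fm W) → PFm V → Fm W
psubst s (pvar x)  = s x
psubst s p⊥        = ⊥f
psubst s (a p∧ b)  = psubst s a ∧f psubst s b
psubst s (a p∨ b)  = psubst s a ∨f psubst s b
psubst s (a p⇒ b)  = psubst s a ⇒f psubst s b

Var : Set
Var = ℕ

-- Given ψ(p₁,…,pₙ,q₁,…,qₘ) with variables indexed by Fin n ⊎ Fin m and an
-- assignment σ of actual propositional variables, the formula
-- ψ(p₁,…,pₙ, q₁ ∨ ∼q₁, …, qₘ ∨ ∼qₘ).
instQ : {n m : ℕ} → (Fin n ⊎ Fin m → Var) → PFm (Fin n ⊎ Fin m) → Fm Var
instQ σ ψ = psubst s ψ
  where
  s : _ → Fm Var
  s (inj₁ i) = var (σ (inj₁ i))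
  s (inj₂ j) = var (σ (inj₂ j)) ∨f (∼f var (σ (inj₂ j)))

module _ {c ℓ₁ ℓ₂ : Level} (H : HeytingAlgebra c ℓ₁ ℓ₂) where
  open HeytingAlgebra H

  ¬_ : Carrier → Carrier
  ¬ a = a ⇨ ⊥

  Dense : Carrier → Set ℓ₁
  Dense a = ¬ a ≈ ⊥

  record IsFilter {ℓ} (F : Pred Carrier ℓ) : Set (c ⊔ ℓ ⊔ ℓ₂) where
    field
      top∈   : ⊤ ∈ F
      upward : ∀ {a b} → a ≤ b → a ∈ F → b ∈ F
      meet∈  : ∀ {a b} → a ∈ F → b ∈ F → (a ∧ b) ∈ F

  record IsIdeal {ℓ} (I : Pred Carrier ℓ) : Set (c ⊔ ℓ ⊔ ℓ₂) where
    field
      bot∈     : ⊥ ∈ I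
      downward : ∀ {a b} → a ≤ b → b ∈ I → a ∈ I
      join∈    : ∀ {a b} → a ∈ I → b ∈ I → (a ∨ b) ∈ I

  ContainsDense : ∀ {ℓ} → Pred Carrier ℓ → Set (c ⊔ ℓ ⊔ ℓ₁)
  ContainsDense F = ∀ a → Dense a → a ∈ F

  Pair : Set c
  Pair = Carrier × Carrier

  _∨t_ : Pair → Pair → Pair
  (a , b) ∨t (c' , d) = (a ∨ c' , b ∧ d)

  _∧t_ : Pair → Pair → Pair
  (a , b) ∧t (c' , d) = (a ∧ c' , b ∨ d)

  _⇒t_ : Pair → Pair → Pair
  (a , b) ⇒t (c' , d) = (a ⇨ c' , a ∧ d)

  ⊥t : Pair
  ⊥t = (⊥ , ⊤)

  ∼t : Pair → Pair
  ∼t (a , b) = (b , a)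

  InTw : ∀ {ℓ ℓ'} → Pred Carrier ℓ → Pred Carrier ℓ' → Pair → Set (ℓ ⊔ ℓ')
  InTw ∇ Δ (a , b) = ((a ∨ b) ∈ ∇) × ((a ∧ b) ∈ Δ)

  eval : {V : Set} → (V → Pair) → Fm V → Pair
  eval v (var x)   = v x
  eval v ⊥f        = ⊥t
  eval v (a ∧f b)  = eval v a ∧t eval v b
  eval v (a ∨f b)  = eval v a ∨t eval v b
  eval v (a ⇒f b)  = eval v a ⇒t eval v b
  eval v (∼f a)    = ∼t (eval v a)

  TwModels : ∀ {ℓ ℓ'} → Pred Carrier ℓ → Pred Carrier ℓ' → Fm Var → Set (c ⊔ ℓ ⊔ ℓ' ⊔ ℓ₁)
  TwModels ∇ Δ φ = (v : Var → Pair) → (∀ x → InTw ∇ Δ (v x)) → proj₁ (eval v φ) ≈ ⊤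

-- On ∼-free connectives the first projection of Tw(A, ∇, Δ) is a
-- homomorphism onto A, and π₁(q ∨ ∼q) = a ∨ b for q ↦ (a , b). So the first
-- projection of φ under v is ψ evaluated in A at π₁ v(pᵢ) and at the joins
-- π₁ v(qⱼ) ∨ π₂ v(qⱼ). These values are realised in Tw(A, ∇, Δ) for every ideal
-- Δ: send qⱼ to (a ∨ b , ⊥) and every other variable to (a , ¬ a), which lies in
-- Tw because a ∨ ¬ a is dense and a ∧ ¬ a = ⊥.
module Submission where

open import Defs hiding (¬_)
open import Level using (Level; 0ℓ)
open import Data.Nat using (ℕ)
open import Data.Fin using (Fin)
open import Data.Sum using (_⊎_; inj₁; inj₂)
open import Data.Product using (_,_; proj₁; ∃)
open import Function.Definitions using (Injective)
open import Relation.Binary.PropositionalEquality using (_≡_)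
import Relation.Binary.PropositionalEquality as ≡
open import Relation.Unary using (Pred; _∈_; _∉_; Decidable)
open import Relation.Nullary using (yes; no; contradiction)
open import Relation.Binary.Lattice.Bundles using (HeytingAlgebra)
open import Function.Bundles using (_⇔_; mk⇔)
open import Function.Base using (_∘_)
import Data.Nat as ℕ
import Data.Fin.Properties as Fin

module _ {c ℓ₁ ℓ₂ : Level} (H : HeytingAlgebra c ℓ₁ ℓ₂) where
  open HeytingAlgebra H
  open import Relation.Binary.Lattice.Properties.HeytingAlgebra H
    using (¬_; de-morgan₁; ⇨-applyʳ; ⇨-cong)
  open import Relation.Binary.Lattice.Properties.MeetSemilattice meetSemilattice
    using (∧-cong)
  open import Relation.Binary.Lattice.Properties.JoinSemilattice joinSemilattice
    using (∨-cong)
  open import Relation.Binary.Lattice.Properties.BoundedJoinSemilattice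
    boundedJoinSemilattice using (identityʳ)

  x∨¬x-dense : ∀ x → Dense H (x ∨ ¬ x)
  x∨¬x-dense x = antisym (trans (reflexive (de-morgan₁ x (¬ x))) (⇨-applyʳ refl))
                         (minimum _)

  ⟦_⟧ : {K : Set} → PFm K → (K → Carrier) → Carrier
  ⟦ pvar k ⟧  ρ = ρ k
  ⟦ p⊥ ⟧      ρ = ⊥
  ⟦ a p∧ b ⟧  ρ = ⟦ a ⟧ ρ ∧ ⟦ b ⟧ ρ
  ⟦ a p∨ b ⟧  ρ = ⟦ a ⟧ ρ ∨ ⟦ b ⟧ ρ
  ⟦ a p⇒ b ⟧  ρ = ⟦ a ⟧ ρ ⇨ ⟦ b ⟧ ρ

  ⟦⟧-cong : {K : Set} {ρ ρ′ : K → Carrier} →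
            (∀ k → ρ k ≈ ρ′ k) → ∀ ψ → ⟦ ψ ⟧ ρ ≈ ⟦ ψ ⟧ ρ′
  ⟦⟧-cong ρ≈ρ′ (pvar k) = ρ≈ρ′ k
  ⟦⟧-cong ρ≈ρ′ p⊥       = Eq.refl
  ⟦⟧-cong ρ≈ρ′ (a p∧ b) = ∧-cong (⟦⟧-cong ρ≈ρ′ a) (⟦⟧-cong ρ≈ρ′ b)
  ⟦⟧-cong ρ≈ρ′ (a p∨ b) = ∨-cong (⟦⟧-cong ρ≈ρ′ a) (⟦⟧-cong ρ≈ρ′ b)
  ⟦⟧-cong ρ≈ρ′ (a p⇒ b) = ⇨-cong (⟦⟧-cong ρ≈ρ′ a) (⟦⟧-cong ρ≈ρ′ b)

  join : Pair H → Carrier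
  join (a , b) = a ∨ b

  module _ {n m : ℕ} (σ : Fin n ⊎ Fin m → Var) where

    instQ-env : (Var → Pair H) → Fin n ⊎ Fin m → Carrier
    instQ-env v (inj₁ i) = proj₁ (v (σ (inj₁ i)))
    instQ-env v (inj₂ j) = join (v (σ (inj₂ j)))

    proj₁-eval-instQ : ∀ v ψ → proj₁ (eval H v (instQ σ ψ)) ≡ ⟦ ψ ⟧ (instQ-env v)
    proj₁-eval-instQ v (pvar (inj₁ i)) = ≡.refl
    proj₁-eval-instQ v (pvar (inj₂ j)) = ≡.refl
    proj₁-eval-instQ v p⊥              = ≡.refl
    proj₁-eval-instQ v (a p∧ b) = ≡.cong₂ _∧_ (proj₁-eval-instQ v a) (proj₁-eval-instQ v b)
    proj₁-eval-instQ v (a p∨ b) = ≡.cong₂ _∨_ (proj₁-eval-instQ v a) (proj₁-eval-instQ v b)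
    proj₁-eval-instQ v (a p⇒ b) = ≡.cong₂ _⇨_ (proj₁-eval-instQ v a) (proj₁-eval-instQ v b)

  module _ {ℓ ℓ′ : Level} {∇ : Pred Carrier ℓ} {Δ : Pred Carrier ℓ′}
           (isFilter : IsFilter H ∇) (isIdeal : IsIdeal H Δ) where
    open IsFilter isFilter using (upward)
    open IsIdeal isIdeal using (bot∈; downward)

    squash : Pair H → Pair H
    squash p = (join p , ⊥)

    squash-∈Tw : ∀ {p} → join p ∈ ∇ → InTw H ∇ Δ (squash p)
    squash-∈Tw p∈∇ = upward (x≤x∨y _ _) p∈∇ , downward (x∧y≤y _ _) bot∈

    regular-∈Tw : ContainsDense H ∇ → ∀ a → InTw H ∇ Δ (a , ¬ a)
    regular-∈Tw dense⊆∇ a = dense⊆∇ _ (x∨¬x-dense a) , downward (⇨-applyʳ refl) bot∈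

    module _ {q : Level} {Q : Pred Var q} (Q? : Decidable Q) where

      collapse : (Var → Pair H) → Var → Pair H
      collapse v x with Q? x
      ... | yes _ = squash (v x)
      ... | no _  = (proj₁ (v x) , ¬ proj₁ (v x))

      collapse-∈Tw : ContainsDense H ∇ →
                     ∀ v → (∀ x → join (v x) ∈ ∇) → ∀ x → InTw H ∇ Δ (collapse v x)
      collapse-∈Tw dense⊆∇ v join∈∇ x with Q? x
      ... | yes _ = squash-∈Tw (join∈∇ x)
      ... | no _  = regular-∈Tw dense⊆∇ (proj₁ (v x))

      collapse-∈ : ∀ v {x} → x ∈ Q → join (collapse v x) ≈ join (v x)
      collapse-∈ v {x} x∈Q with Q? x
      ... | yes _  = identityʳ _
      ... | no x∉Q = contradiction x∈Q x∉Q

      collapse-∉ : ∀ v {x} → x ∉ Q → proj₁ (collapse v x) ≡ proj₁ (v x)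
      collapse-∉ v {x} x∉Q with Q? x
      ... | yes x∈Q = contradiction x∈Q x∉Q
      ... | no _    = ≡.refl

  module _ {n m : ℕ} {σ : Fin n ⊎ Fin m → Var} (σ-injective : Injective _≡_ _≡_ σ) where

    QVar : Pred Var 0ℓ
    QVar x = ∃ λ j → σ (inj₂ j) ≡ x

    QVar? : Decidable QVar
    QVar? x = Fin.any? (λ j → σ (inj₂ j) ℕ.≟ x)

    PVar∉QVar : ∀ i → σ (inj₁ i) ∉ QVar
    PVar∉QVar i (j , eq) with σ-injective eq
    ... | ()

    module _ {ℓ ℓ′ : Level} {∇ : Pred Carrier ℓ} {Δ : Pred Carrier ℓ′}
             (isFilter : IsFilter H ∇) (isIdeal : IsIdeal H Δ) where

      instQ-env-collapse : ∀ v k →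
        instQ-env σ (collapse isFilter isIdeal QVar? v) k ≈ instQ-env σ v k
      instQ-env-collapse v (inj₁ i) =
        Eq.reflexive (collapse-∉ isFilter isIdeal QVar? v (PVar∉QVar i))
      instQ-env-collapse v (inj₂ j) = collapse-∈ isFilter isIdeal QVar? v (j , ≡.refl)

      TwModels-instQ-transfer : ∀ {ℓ″} (Δ′ : Pred Carrier ℓ″) → ContainsDense H ∇ → ∀ ψ →
        TwModels H ∇ Δ (instQ σ ψ) → TwModels H ∇ Δ′ (instQ σ ψ)
      TwModels-instQ-transfer Δ′ dense⊆∇ ψ ⊨φ v v∈Tw = begin
        proj₁ (eval H v (instQ σ ψ))  ≡⟨ proj₁-eval-instQ σ v ψ ⟩
        ⟦ ψ ⟧ (instQ-env σ v)         ≈⟨ ⟦⟧-cong (instQ-env-collapse v) ψ ⟨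
        ⟦ ψ ⟧ (instQ-env σ w)         ≡⟨ proj₁-eval-instQ σ w ψ ⟨
        proj₁ (eval H w (instQ σ ψ))  ≈⟨ ⊨φ w w∈Tw ⟩
        ⊤                             ∎
        where
        open import Relation.Binary.Reasoning.Setoid setoid
        w : Var → Pair H
        w = collapse isFilter isIdeal QVar? v
        w∈Tw : ∀ x → InTw H ∇ Δ (w x)
        w∈Tw = collapse-∈Tw isFilter isIdeal QVar? dense⊆∇ v (proj₁ ∘ v∈Tw)

lemma4p1p4 : {c ℓ₁ ℓ₂ ℓ ℓ' ℓ'' : Level} (H : HeytingAlgebra c ℓ₁ ℓ₂)
    (∇ : Pred (HeytingAlgebra.Carrier H) ℓ) (Δ₁ : Pred (HeytingAlgebra.Carrier H) ℓ')
    (Δ₂ : Pred (HeytingAlgebra.Carrier H) ℓ'') →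
    IsFilter H ∇ → ContainsDense H ∇ → IsIdeal H Δ₁ → IsIdeal H Δ₂ →
    (n m : ℕ) (σ : Fin n ⊎ Fin m → Var) → Injective _≡_ _≡_ σ →
    (ψ : PFm (Fin n ⊎ Fin m)) →
    TwModels H ∇ Δ₁ (instQ σ ψ) ⇔ TwModels H ∇ Δ₂ (instQ σ ψ)
lemma4p1p4 H ∇ Δ₁ Δ₂ isFilter dense⊆∇ isIdeal₁ isIdeal₂ n m σ σ-injective ψ =
  mk⇔ (TwModels-instQ-transfer H σ-injective isFilter isIdeal₁ Δ₂ dense⊆∇ ψ)
      (TwModels-instQ-transfer H σ-injective isFilter isIdeal₂ Δ₁ dense⊆∇ ψ)
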